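{- If a digraph $D$ contains a supervising vertex, then there exists a dominating set $S$ of $D$ such that $|\mathcal P_{S}|\geq |S|-1$.
   Context: Digraphs are finite and loopless, not necessarily simple. A supervising vertex is a vertex $s$ such that every vertex of $D$ is reachable from $s$ by a directed path. A set $S$ of vertices is dominating if every vertex not in $S$ has an in-neighbour in $S$. For $S\subseteq V(D)$, the $S$-partition $\mathcal P_S$ is the partition of $V(D)\setminus S$ in which two vertices are in the same part iff they have the same set of in-neighbours in $S$; $|\mathcal P_S|$ is its number of parts. -}

module Defs where

open import Data.Nat using (ℕ; suc; _≤_; _+_)
open import Data.Fin using (Fin)
open import Data.Fin.Subset using (Subset; _∈_; _∉_)
open import Data.Bool using (Bool; true; false; _∧_)
import Data.Bool.Properties as BoolP
open import Data.Vec using (Vec; tabulate; lookup)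
import Data.Vec.Properties as VecP
open import Data.List using (List; length; map; filter; deduplicate; allFin)
open import Data.Product using (∃; _×_; _,_)
open import Relation.Binary.PropositionalEquality using (_≡_)

-- Parallel arcs are
-- irrelevant for reachability and in-neighbourhoods, so arcs are recorded
-- by a Boolean adjacency relation: arc u v ≡ true iff there is an arc u → v.
record Digraph (n : ℕ) : Set where
  field
    arc      : Fin n → Fin n → Bool
    loopless : ∀ v → arc v v ≡ false
open Digraph public

data Reach {n : ℕ} (D : Digraph n) : Fin n → Fin n → Set where
  here : ∀ {v} → Reach D v v
  step : ∀ {u w v} → arc D u w ≡ true → Reach D w v → Reach D u v

Supervising : ∀ {n} → Digraph n → Fin n → Set
Supervising D s = ∀ v → Reach D s v

Dominating : ∀ {n} → Digraph n → Subset n → Set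
Dominating {n} D S = ∀ v → v ∉ S → ∃ λ u → u ∈ S × arc D u v ≡ true

inNbrsIn : ∀ {n} → Digraph n → Subset n → Fin n → Subset n
inNbrsIn D S v = tabulate (λ u → lookup S u ∧ arc D u v)

outside : ∀ {n} → Subset n → List (Fin n)
outside {n} S = filter (λ v → lookup S v BoolP.≟ false) (allFin n)

-- |P_S| : number of parts of the S-partition of V(D) \ S, i.e. the number
-- of distinct sets N⁻(v) ∩ S for v ∉ S.
partitionSize : ∀ {n} → Digraph n → Subset n → ℕ
partitionSize D S =
  length (deduplicate (VecP.≡-dec BoolP._≟_) (map (inNbrsIn D S) (outside S)))

-- Start from S = V and repeatedly shrink the potential Σ_{x ∈ S} (dist(s, x) + 1)
-- while keeping S dominating.  If some x ∈ S other than s has no private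
-- out-neighbour, i.e. no y ∉ S with N⁻(y) ∩ S = {x}, then every vertex outside S
-- is dominated by S ∖ {x}; so x can be exchanged for an in-neighbour u of x
-- (one in S if there is one, otherwise the predecessor of x on a shortest path
-- from s), and the potential drops.  At the end every x ∈ S ∖ {s} owns a part
-- {y : N⁻(y) ∩ S = {x}} of the S-partition, and these parts are distinct.
module Submission where

open import Defs
open import Data.Nat using (ℕ; zero; suc; _≤_; _<_; _+_; z≤n; s≤s; z<s)
import Data.Nat.Properties as ℕ
open import Data.Nat.Induction using (<-wellFounded)
open import Induction.WellFounded using (Acc; acc)
open import Data.Fin using (Fin; zero; suc; _≟_; punchIn)
open import Data.Fin.Properties using (any?; suc-injective; 0≢1+n; punchInᵢ≢i)
open import Data.Fin.Subset using (Subset; ∣_∣; _∈_; _∉_; ⁅_⁆; ⊤)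
open import Data.Fin.Subset.Properties using (_∈?_; ∈⊤; x∈⁅x⁆; x∈⁅y⁆⇒x≡y; ⊆-antisym)
open import Data.Bool using (true; false; _∧_; if_then_else_)
import Data.Bool.Properties as Bool
open import Data.Vec using ([]; _∷_; lookup; _[_]≔_; here; there)
import Data.Vec.Properties as Vec
open import Data.Vec.Functional using (removeAt)
open import Data.List using (List; _∷_; length; map; deduplicate)
open import Data.List.Properties using (length-removeAt′)
import Data.List.Relation.Unary.Any as Any
open import Data.List.Relation.Unary.Any using (_─_)
open import Data.List.Membership.Propositional using () renaming (_∈_ to _∈ₗ_)
open import Data.List.Membership.Propositional.Properties
  using (∈-map⁺; ∈-filter⁺; ∈-allFin; ∈-deduplicate⁺)
open import Algebra.Properties.CommutativeMonoid.Sum ℕ.+-0-commutativeMonoid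
  using (sum; sum-remove; sum-cong-≗)
open import Algebra.Properties.CommutativeSemigroup ℕ.+-commutativeSemigroup using (xy∙z≈zy∙x)
open import Data.Product using (∃; _×_; _,_; proj₁; proj₂; map₁)
open import Function using (_∘_)
open import Function.Definitions using (Injective)
open import Relation.Nullary using (¬_; Dec; yes; no; contradiction)
open import Relation.Nullary.Decidable using (_×-dec_; ¬?; decidable-stable)
open import Relation.Unary using (Decidable)
open import Relation.Binary.PropositionalEquality
  using (_≡_; _≢_; refl; sym; trans; cong; cong₂; subst; module ≡-Reasoning)

module _ {a} {A : Set a} where

  ∈-─⁺ : ∀ {x y : A} {ys} (x∈ys : x ∈ₗ ys) → y ≢ x → y ∈ₗ ys → y ∈ₗ (ys ─ x∈ys)
  ∈-─⁺ (Any.here refl)  y≢x (Any.here refl)  = contradiction refl y≢x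
  ∈-─⁺ (Any.here _)     _   (Any.there y∈ys) = y∈ys
  ∈-─⁺ (Any.there _)    _   (Any.here y≡z)   = Any.here y≡z
  ∈-─⁺ (Any.there x∈ys) y≢x (Any.there y∈ys) = Any.there (∈-─⁺ x∈ys y≢x y∈ys)

  ∣p∣≤length : ∀ {n} {p : Subset n} {ys : List A} (f : Fin n → A) → Injective _≡_ _≡_ f →
               (∀ {x} → x ∈ p → f x ∈ₗ ys) → ∣ p ∣ ≤ length ys
  ∣p∣≤length {p = []}         _ _   _   = z≤n
  ∣p∣≤length {p = false ∷ p} f inj mem = ∣p∣≤length (f ∘ suc) (suc-injective ∘ inj) (mem ∘ there)
  ∣p∣≤length {p = true ∷ p} {ys} f inj mem = begin
    suc ∣ p ∣                 ≤⟨ s≤s (∣p∣≤length (f ∘ suc) (suc-injective ∘ inj) mem′) ⟩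
    suc (length (ys ─ f0∈ys)) ≡⟨ length-removeAt′ ys _ ⟨
    length ys                 ∎
    where
    open ℕ.≤-Reasoning
    f0∈ys : f zero ∈ₗ ys
    f0∈ys = mem here
    mem′ : ∀ {x} → x ∈ p → f (suc x) ∈ₗ (ys ─ f0∈ys)
    mem′ x∈p = ∈-─⁺ f0∈ys (λ e → 0≢1+n (sym (inj e))) (mem (there x∈p))

∧≡true⁻ : ∀ {a b} → a ∧ b ≡ true → a ≡ true × b ≡ true
∧≡true⁻ {true} {true} refl = refl , refl

⁅⁆-injective : ∀ {n} → Injective _≡_ _≡_ (⁅_⁆ {n})
⁅⁆-injective {x = x} {y} ⁅x⁆≡⁅y⁆ = x∈⁅y⁆⇒x≡y y (subst (x ∈_) ⁅x⁆≡⁅y⁆ (x∈⁅x⁆ x))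

module _ {n} {p : Subset n} where

  ∉⇒lookup≡false : ∀ {x} → x ∉ p → lookup p x ≡ false
  ∉⇒lookup≡false {x} x∉p with lookup p x in eq
  ... | true  = contradiction (Vec.lookup⇒[]= x p eq) x∉p
  ... | false = refl

  ∈-[]≔⁺ : ∀ {x y b} → y ∈ p → y ≢ x → y ∈ p [ x ]≔ b
  ∈-[]≔⁺ y∈p y≢x = Vec.[]≔-minimal p _ _ y≢x y∈p

  ∈-[]≔⁻ : ∀ {x y b} → y ∈ p [ x ]≔ b → y ≢ x → y ∈ p
  ∈-[]≔⁻ {x} {y} {b} y∈p′ y≢x =
    Vec.lookup⇒[]= y p (trans (sym (Vec.lookup∘update′ y≢x p b)) (Vec.[]=⇒lookup y∈p′))

  ∈-[]≔true : ∀ {x y} → y ∈ p → y ∈ p [ x ]≔ true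
  ∈-[]≔true {x} {y} y∈p with y ≟ x
  ... | yes refl = Vec.[]≔-updates p x
  ... | no y≢x   = ∈-[]≔⁺ y∈p y≢x

weight : ∀ {n} → (Fin n → ℕ) → Subset n → ℕ
weight w p = sum (λ i → if lookup p i then w i else 0)

weight-[]≔ : ∀ {n} (w : Fin n → ℕ) p i b →
             weight w (p [ i ]≔ b) + (if lookup p i then w i else 0) ≡ weight w p + (if b then w i else 0)
weight-[]≔ {suc _} w p i b = begin
  weight w p′ + term p i                            ≡⟨ cong (_+ term p i) (sum-remove (term p′)) ⟩
  term p′ i + sum (removeAt (term p′) i) + term p i ≡⟨ cong₂ (λ c r → c + r + term p i) new rest ⟩
  term′ + sum (removeAt (term p) i) + term p i      ≡⟨ xy∙z≈zy∙x term′ _ (term p i) ⟩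
  term p i + sum (removeAt (term p) i) + term′      ≡⟨ cong (_+ term′) (sum-remove (term p)) ⟨
  weight w p + term′                                ∎
  where
  open ≡-Reasoning
  p′ : Subset _
  p′ = p [ i ]≔ b
  term : Subset _ → Fin _ → ℕ
  term q j = if lookup q j then w j else 0
  term′ : ℕ
  term′ = if b then w i else 0
  new : term p′ i ≡ term′
  new = cong (λ c → if c then w i else 0) (Vec.lookup∘update i p b)
  rest : sum (removeAt (term p′) i) ≡ sum (removeAt (term p) i)
  rest = sum-cong-≗ λ j → cong (λ c → if c then w (punchIn i j) else 0)
                               (Vec.lookup∘update′ (punchInᵢ≢i i j) p b)

module _ {n} (w : Fin n → ℕ) {p : Subset n} {x : Fin n} where

  weight-remove : x ∈ p → weight w (p [ x ]≔ false) + w x ≡ weight w p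
  weight-remove x∈p = trans
    (subst (λ c → weight w (p [ x ]≔ false) + (if c then w x else 0) ≡ weight w p + 0)
           (Vec.[]=⇒lookup x∈p) (weight-[]≔ w p x false))
    (ℕ.+-identityʳ _)

  weight-insert : x ∉ p → weight w (p [ x ]≔ true) ≡ weight w p + w x
  weight-insert x∉p = trans
    (sym (ℕ.+-identityʳ _))
    (subst (λ c → weight w (p [ x ]≔ true) + (if c then w x else 0) ≡ weight w p + w x)
           (∉⇒lookup≡false x∉p) (weight-[]≔ w p x true))

module _ {p} {P : ℕ → Set p} (P? : Decidable P) where

  least-witness : ∀ {k} → P k → ∃ λ m → P m × (∀ {j} → P j → m ≤ j)
  least-witness {k} = go k (<-wellFounded k)
    where
    go : ∀ k → Acc _<_ k → P k → ∃ λ m → P m × (∀ {j} → P j → m ≤ j)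
    go k (acc smaller) Pk with ℕ.anyUpTo? P? k
    ... | yes (j , j<k , Pj) = go j (smaller j<k) Pj
    ... | no noneBelow       = k , Pk , λ {j} Pj → ℕ.≮⇒≥ (λ j<k → noneBelow (j , j<k , Pj))

module _ {n} (D : Digraph n) where

  ∈-inNbrsIn⁺ : ∀ {S u v} → u ∈ S → arc D u v ≡ true → u ∈ inNbrsIn D S v
  ∈-inNbrsIn⁺ {S} {u} u∈S uv = Vec.lookup⇒[]= u _
    (trans (Vec.lookup∘tabulate _ u) (cong₂ _∧_ (Vec.[]=⇒lookup u∈S) uv))

  ∈-inNbrsIn⁻ : ∀ {S u v} → u ∈ inNbrsIn D S v → u ∈ S × arc D u v ≡ true
  ∈-inNbrsIn⁻ {S} {u} u∈N = map₁ (Vec.lookup⇒[]= u S)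
    (∧≡true⁻ (trans (sym (Vec.lookup∘tabulate _ u)) (Vec.[]=⇒lookup u∈N)))

  arc⇒≢ : ∀ {u v} → arc D u v ≡ true → u ≢ v
  arc⇒≢ {u} uv refl with () ← trans (sym uv) (loopless D u)

  ⊤-dominating : Dominating D ⊤
  ⊤-dominating _ v∉⊤ = contradiction ∈⊤ v∉⊤

  PrivateOutNbr : Subset n → Fin n → Fin n → Set
  PrivateOutNbr S x y = y ∉ S × inNbrsIn D S y ≡ ⁅ x ⁆

  privateOutNbr? : ∀ S x y → Dec (PrivateOutNbr S x y)
  privateOutNbr? S x y = ¬? (y ∈? S) ×-dec Vec.≡-dec Bool._≟_ (inNbrsIn D S y) ⁅ x ⁆

  HasPrivateOutNbrs : Fin n → Subset n → Set
  HasPrivateOutNbrs s S = ∀ x → x ∈ S → x ≢ s → ∃ (PrivateOutNbr S x)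

  -- The vertex s, which may lack a private out-neighbour, is charged to the extra entry ⁅ s ⁆.
  ∣S∣≤partitionSize+1 : ∀ {S} s → HasPrivateOutNbrs s S → ∣ S ∣ ≤ partitionSize D S + 1
  ∣S∣≤partitionSize+1 {S} s hasPrivate = begin
    ∣ S ∣                  ≤⟨ ∣p∣≤length ⁅_⁆ ⁅⁆-injective ⁅x⁆∈parts ⟩
    length (⁅ s ⁆ ∷ parts) ≡⟨ ℕ.+-comm 1 _ ⟩
    partitionSize D S + 1  ∎
    where
    open ℕ.≤-Reasoning
    parts : List (Subset n)
    parts = deduplicate (Vec.≡-dec Bool._≟_) (map (inNbrsIn D S) (outside S))
    ⁅x⁆∈parts : ∀ {x} → x ∈ S → ⁅ x ⁆ ∈ₗ ⁅ s ⁆ ∷ parts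
    ⁅x⁆∈parts {x} x∈S with x ≟ s
    ... | yes refl = Any.here refl
    ... | no x≢s with hasPrivate x x∈S x≢s
    ...   | y , y∉S , N⁻y≡⁅x⁆ = Any.there (subst (_∈ₗ parts) N⁻y≡⁅x⁆
            (∈-deduplicate⁺ (Vec.≡-dec Bool._≟_) (∈-map⁺ (inNbrsIn D S)
              (∈-filter⁺ (λ v → lookup S v Bool.≟ false) (∈-allFin y) (∉⇒lookup≡false y∉S)))))

  module _ {S x} (dom : Dominating D S) (noPrivate : ¬ ∃ (PrivateOutNbr S x)) where

    dominated-without : ∀ v → v ∉ S → ∃ λ u → u ∈ S × u ≢ x × arc D u v ≡ true
    dominated-without v v∉S with any? (λ u → u ∈? S ×-dec ¬? (u ≟ x) ×-dec arc D u v Bool.≟ true)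
    ... | yes found = found
    ... | no none   = contradiction (v , v∉S , N⁻v≡⁅x⁆) noPrivate
      where
      only-x : ∀ {u} → u ∈ S → arc D u v ≡ true → u ≡ x
      only-x {u} u∈S uv = decidable-stable (u ≟ x) (λ u≢x → none (u , u∈S , u≢x , uv))
      x∈N⁻v : x ∈ inNbrsIn D S v
      x∈N⁻v with dom v v∉S
      ... | u , u∈S , uv with refl ← only-x u∈S uv = ∈-inNbrsIn⁺ u∈S uv
      N⁻v≡⁅x⁆ : inNbrsIn D S v ≡ ⁅ x ⁆
      N⁻v≡⁅x⁆ = ⊆-antisym
        (λ u∈N⁻v → let (u∈S , uv) = ∈-inNbrsIn⁻ u∈N⁻v
                   in subst (_∈ ⁅ x ⁆) (sym (only-x u∈S uv)) (x∈⁅x⁆ x))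
        (λ u∈⁅x⁆ → subst (_∈ inNbrsIn D S v) (sym (x∈⁅y⁆⇒x≡y x u∈⁅x⁆)) x∈N⁻v)

    exchange-dominating : ∀ {S′ u} → (∀ {v} → v ∈ S → v ≢ x → v ∈ S′) → u ∈ S′ →
                          arc D u x ≡ true → Dominating D S′
    exchange-dominating {S′} {u} keep u∈S′ ux v v∉S′ with v ≟ x
    ... | yes refl = u , u∈S′ , ux
    ... | no v≢x with dominated-without v (λ v∈S → v∉S′ (keep v∈S v≢x))
    ...   | w , w∈S , w≢x , wv = w , keep w∈S w≢x , wv

module Distance {n} (D : Digraph n) (s : Fin n) where

  ReachableIn : ℕ → Fin n → Set
  ReachableIn zero    v = v ≡ s
  ReachableIn (suc k) v = ∃ λ u → ReachableIn k u × arc D u v ≡ true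

  reachableIn? : ∀ k v → Dec (ReachableIn k v)
  reachableIn? zero    v = v ≟ s
  reachableIn? (suc k) v = any? (λ u → reachableIn? k u ×-dec arc D u v Bool.≟ true)

  Reach⇒ReachableIn : ∀ {k u v} → ReachableIn k u → Reach D u v → ∃ λ m → ReachableIn m v
  Reach⇒ReachableIn r here         = _ , r
  Reach⇒ReachableIn r (step uw wv) = Reach⇒ReachableIn (_ , r , uw) wv

  module ShortestPaths (supervising : Supervising D s) where

    shortest : ∀ v → ∃ λ m → ReachableIn m v × (∀ {j} → ReachableIn j v → m ≤ j)
    shortest v = least-witness (λ k → reachableIn? k v) (proj₂ (Reach⇒ReachableIn refl (supervising v)))

    dist : Fin n → ℕ
    dist v = proj₁ (shortest v)

    last-arc : ∀ {m v} → ReachableIn m v → v ≢ s → ∃ λ u → arc D u v ≡ true × dist u < m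
    last-arc {zero}  v≡s          v≢s = contradiction v≡s v≢s
    last-arc {suc _} (u , r , uv) _   = u , uv , s≤s (proj₂ (proj₂ (shortest u)) r)

    parent : ∀ {v} → v ≢ s → ∃ λ u → arc D u v ≡ true × dist u < dist v
    parent {v} = last-arc (proj₁ (proj₂ (shortest v)))

module Descent {n} (D : Digraph n) (s : Fin n) (supervising : Supervising D s) where

  open Distance.ShortestPaths D s supervising using (dist; parent)

  potential : Subset n → ℕ
  potential = weight (suc ∘ dist)

  Improvement : Subset n → Set
  Improvement S = ∃ λ S′ → Dominating D S′ × potential S′ < potential S

  module _ {S x} (dom : Dominating D S) (x∈S : x ∈ S) (noPrivate : ¬ ∃ (PrivateOutNbr D S x)) where

    drop-redundant : ∀ {u} → u ∈ S → arc D u x ≡ true → Improvement S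
    drop-redundant u∈S ux =
        S [ x ]≔ false
      , exchange-dominating D dom noPrivate ∈-[]≔⁺ (∈-[]≔⁺ u∈S (arc⇒≢ D ux)) ux
      , subst (potential (S [ x ]≔ false) <_) (weight-remove _ x∈S) (ℕ.m<m+n _ z<s)

    replace-by-parent : x ≢ s → (∀ {u} → u ∈ S → arc D u x ≢ true) → Improvement S
    replace-by-parent x≢s noInNbr with parent x≢s
    ... | w , wx , dw<dx =
        S₁
      , exchange-dominating D dom noPrivate (λ v∈S v≢x → ∈-[]≔true (∈-[]≔⁺ v∈S v≢x))
                            (Vec.[]≔-updates S₀ w) wx
      , (begin-strict
          potential S₁                 ≡⟨ weight-insert _ w∉S₀ ⟩
          potential S₀ + suc (dist w)  <⟨ ℕ.+-monoʳ-< (potential S₀) (s≤s dw<dx) ⟩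
          potential S₀ + suc (dist x)  ≡⟨ weight-remove _ x∈S ⟩
          potential S                  ∎)
      where
      open ℕ.≤-Reasoning
      S₀ S₁ : Subset n
      S₀ = S [ x ]≔ false
      S₁ = S₀ [ w ]≔ true
      w∉S₀ : w ∉ S₀
      w∉S₀ w∈S₀ = noInNbr (∈-[]≔⁻ w∈S₀ (arc⇒≢ D wx)) wx

    improve : x ≢ s → Improvement S
    improve x≢s with any? (λ u → u ∈? S ×-dec arc D u x Bool.≟ true)
    ... | yes (u , u∈S , ux) = drop-redundant u∈S ux
    ... | no noInNbr         = replace-by-parent x≢s (λ u∈S ux → noInNbr (_ , u∈S , ux))

  descend : ∀ S → Acc _<_ (potential S) → Dominating D S →
            ∃ λ S′ → Dominating D S′ × HasPrivateOutNbrs D s S′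
  descend S (acc smaller) dom
    with any? (λ x → x ∈? S ×-dec ¬? (x ≟ s) ×-dec ¬? (any? (privateOutNbr? D S x)))
  ... | no noneLacking = S , dom , λ x x∈S x≢s →
    decidable-stable (any? (privateOutNbr? D S x)) (λ noPrivate → noneLacking (x , x∈S , x≢s , noPrivate))
  ... | yes (x , x∈S , x≢s , noPrivate) with improve dom x∈S noPrivate x≢s
  ...   | S′ , dom′ , decrease = descend S′ (smaller decrease) dom′

lemma17 : ∀ {n} (D : Digraph n) → ∃ (λ s → Supervising D s) →
    ∃ λ (S : Subset n) → Dominating D S × ∣ S ∣ ≤ partitionSize D S + 1
lemma17 D (s , supervising) =
  let S , dom , hasPrivate = descend ⊤ (<-wellFounded _) (⊤-dominating D)
  in  S , dom , ∣S∣≤partitionSize+1 D s hasPrivate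
  where open Descent D s supervising
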